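{- Let $k$ be an infinite field, let $\Delta$ be a $(d-1)$-dimensional simplicial complex, and let $s$ be a nonnegative integer. If $\Delta$ is $s$-Lefschetz over $k$, then the cone $\mathrm{cone}(\Delta)$ is $s$-Lefschetz over $k$.
   Context: $\mathrm{cone}(\Delta)=\{F:F\in\Delta\}\cup\{F\cup\{v\}:F\in\Delta\}$ for a new vertex $v\notin\Delta$. For a simplicial complex $\Gamma$ on vertex set $V$, $k[\Gamma]=A/I_\Gamma$ with $A=k[x_v:v\in V]$ graded by degree and $I_\Gamma$ generated by the monomials $x_{v_1}\cdots x_{v_t}$ with $\{v_1,\dots,v_t\}\notin\Gamma$. A maximal linear system of parameters (l.s.o.p.) for $k[\Gamma]$ is a set $\Theta$ of $\dim\Gamma+1$ linear forms in $A_1$ with $k[\Gamma]/\Theta k[\Gamma]$ finite-dimensional over $k$; write $k[\Gamma]/\Theta$ for this graded quotient. $\Gamma$ is $s$-Lefschetz over $k$ if there exist a maximal l.s.o.p. $\Theta$ for $k[\Gamma]$ and $\omega\in A_1$ such that $\omega^{s-2i}:(k[\Gamma]/\Theta)_i\to(k[\Gamma]/\Theta)_{s-i}$ is injective for all $0\le i\le\lfloor\frac{s-1}{2}\rfloor$. -}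

module Defs where

open import Level using (Level; _⊔_) renaming (suc to lsuc)
open import Algebra.Bundles using (CommutativeRing)
open import Data.Nat as ℕ using (ℕ; zero; suc; _<_) renaming (_+_ to _+ℕ_; _*_ to _*ℕ_; _∸_ to _∸ℕ_)
open import Data.Bool using (Bool; true; false)
open import Data.Fin using (Fin)
open import Data.Bool using (if_then_else_)
open import Data.Fin.Subset using (Subset; _⊆_; ∣_∣) renaming (_∈_ to _∈ₛ_)
open import Data.Vec using (Vec; []; _∷_; replicate; zipWith; lookup; _[_]≔_; here; there) renaming (map to vmap; sum to vsum)
open import Data.Vec.Properties using (≡-dec)
open import Data.List using (List; []; _∷_; _++_; map; concatMap; foldr; allFin)
open import Data.List.Relation.Unary.All using (All)
open import Data.List.Membership.Propositional using (_∈_)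
import Data.Product
open import Data.Product using (Σ; _×_; _,_; ∃; ∃-syntax)
open import Data.Sum using (_⊎_)
open import Relation.Nullary using (¬_; yes; no)
open import Relation.Binary.PropositionalEquality using (_≡_)

record Field (c ℓ : Level) : Set (lsuc (c ⊔ ℓ)) where
  field
    commRing : CommutativeRing c ℓ
  open CommutativeRing commRing public
  field
    nontrivial : ¬ (1# ≈ 0#)
    inverse    : ∀ x → ¬ (x ≈ 0#) → Σ Carrier λ y → (x * y) ≈ 1#

Infinite : ∀ {c ℓ} → Field c ℓ → Set (c ⊔ ℓ)
Infinite F = ∀ (xs : List Carrier) → Σ Carrier λ x → All (λ y → ¬ (x ≈ y)) xs
  where open Field F

record SimplicialComplex (n : ℕ) : Set₁ where
  field
    Face      : Subset n → Set
    emptyFace : Face (replicate n false)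
    downClosed : ∀ {F G} → G ⊆ F → Face F → Face G

-- HasDim Δ d :  dim Δ = d - 1  (largest face has exactly d vertices).
HasDim : ∀ {n} → SimplicialComplex n → ℕ → Set
HasDim {n} Δ d =
  (Σ (Subset n) λ F → Face F × ∣ F ∣ ≡ d) × (∀ F → Face F → ∣ F ∣ ℕ.≤ d)
  where open SimplicialComplex Δ

-- cone(Δ): new vertex is Fin.zero of Fin (suc n).  A subset b ∷ F of
-- Fin (suc n) is a face iff F ∈ Δ (b says whether the apex is included).
cone : ∀ {n} → SimplicialComplex n → SimplicialComplex (suc n)
cone {n} Δ = record
  { Face = λ { (b ∷ F) → Face F }
  ; emptyFace = emptyFace
  ; downClosed = λ { {_ ∷ F} {_ ∷ G} (G⊆F) fF → downClosed (λ x∈G → tail⊆ G⊆F x∈G) fF }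
  }
  where
  open SimplicialComplex Δ
  tail⊆ : ∀ {b c : Bool} {F G : Subset n} → (c ∷ G) ⊆ (b ∷ F) → ∀ {x} → x ∈ₛ G → x ∈ₛ F
  tail⊆ sub {x} x∈G with sub (there x∈G)
  ... | there p = p

-- Polynomials in A = k[x_0,…,x_{n-1}], as finite formal sums of terms
-- c·x^a (a : exponent vector).  Two polynomials are equal (≈ₚ) iff all
-- their coefficients agree in k.

module Poly {c ℓ : Level} (K : Field c ℓ) where
  open Field K

  Monomial : ℕ → Set
  Monomial n = Vec ℕ n

  Pol : ℕ → Set c
  Pol n = List (Carrier × Monomial n)

  module _ {n : ℕ} where
    coeff : Pol n → Monomial n → Carrier
    coeff []            m = 0#
    coeff ((k , a) ∷ p) m with ≡-dec ℕ._≟_ a m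
    ... | yes _ = k + coeff p m
    ... | no  _ = coeff p m

    _≈ₚ_ : Pol n → Pol n → Set ℓ
    p ≈ₚ q = ∀ m → coeff p m ≈ coeff q m

    _+ₚ_ : Pol n → Pol n → Pol n
    p +ₚ q = p ++ q

    -ₚ_ : Pol n → Pol n
    -ₚ p = map (λ { (k , a) → (- k , a) }) p

    _-ₚ_ : Pol n → Pol n → Pol n
    p -ₚ q = p +ₚ (-ₚ q)

    _*ₚ_ : Pol n → Pol n → Pol n
    p *ₚ q = concatMap (λ { (k , a) → map (λ { (l , b) → (k * l , zipWith _+ℕ_ a b) }) q }) p

    const : Carrier → Pol n
    const k = (k , replicate n 0) ∷ []

    sumₚ : List (Pol n) → Pol n
    sumₚ = foldr _+ₚ_ []

    _^ₚ_ : Pol n → ℕ → Pol n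
    p ^ₚ zero  = const 1#
    p ^ₚ suc k = p *ₚ (p ^ₚ k)

    var : Fin n → Pol n
    var i = (1# , (replicate n 0 [ i ]≔ 1)) ∷ []

    LinForm : Set c
    LinForm = Vec Carrier n

    linPoly : LinForm → Pol n
    linPoly θ = concatMap (λ i → (const (lookup θ i)) *ₚ var i) (allFin n)

    sqfree : Subset n → Pol n
    sqfree G = (1# , vmap (λ b → if b then 1 else 0) G) ∷ []

    Homogeneous : ℕ → Pol n → Set c
    Homogeneous i p = All (λ t → vsum (Data.Product.proj₂ t) ≡ i) p

    InIdeal : ∀ {s} → (Pol n → Set s) → Pol n → Set (c ⊔ ℓ ⊔ s)
    InIdeal S f = Σ (List (Pol n × Pol n)) λ l →
      All (λ qg → S (Data.Product.proj₂ qg)) l ×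
      (f ≈ₚ sumₚ (map (λ qg → Data.Product.proj₁ qg *ₚ Data.Product.proj₂ qg) l))

  -- Generators of I_Γ + (Θ) ⊆ A, so that k[Γ]/Θ = A/(I_Γ + ΘA):
  -- the θ_j, and the monomials x_{v_1}⋯x_{v_t} with {v_1,…,v_t} ∉ Γ.
  Gen : ∀ {n d} → SimplicialComplex n → Vec (LinForm {n}) d → Pol n → Set c
  Gen {n} {d} Γ Θ g =
    (Σ (Fin d) λ j → g ≡ linPoly (lookup Θ j)) ⊎
    (Σ (Subset n) λ G → ¬ SimplicialComplex.Face Γ G × g ≡ sqfree G)

  FiniteDimQuot : ∀ {n d} → SimplicialComplex n → Vec (LinForm {n}) d → Set (c ⊔ ℓ)
  FiniteDimQuot {n} Γ Θ =
    Σ (List (Pol n)) λ B → ∀ (f : Pol n) →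
      Σ (List (Carrier × Pol n)) λ cs →
        All (λ cb → Data.Product.proj₂ cb ∈ B) cs ×
        InIdeal (Gen Γ Θ)
          (f -ₚ sumₚ (map (λ cb → const (Data.Product.proj₁ cb) *ₚ Data.Product.proj₂ cb) cs))

  -- Θ is a maximal l.s.o.p. for k[Γ]: dim Γ + 1 = d linear forms with
  -- k[Γ]/Θk[Γ] finite-dimensional.
  IsMaxLSOP : ∀ {n d} → SimplicialComplex n → Vec (LinForm {n}) d → Set (c ⊔ ℓ)
  IsMaxLSOP {n} {d} Γ Θ = HasDim Γ d × FiniteDimQuot Γ Θ

-- Γ is s-Lefschetz over k: there are a maximal l.s.o.p. Θ and ω ∈ A_1 with
-- ω^{s-2i} : (k[Γ]/Θ)_i → (k[Γ]/Θ)_{s-i} injective for 0 ≤ i ≤ ⌊(s-1)/2⌋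
-- (i.e. 2i < s).  Elements of (k[Γ]/Θ)_i are classes of homogeneous
-- degree-i polynomials; injectivity: ω^{s-2i} f ∈ J ⇒ f ∈ J.
Lefschetz : ∀ {c ℓ} (K : Field c ℓ) {n : ℕ} → SimplicialComplex n → ℕ → Set (c ⊔ ℓ)
Lefschetz K {n} Γ s =
  Σ ℕ λ d → Σ (Vec (LinForm {n}) d) λ Θ → IsMaxLSOP Γ Θ ×
    Σ (LinForm {n}) λ ω →
      ∀ (i : ℕ) → 2 *ℕ i < s → ∀ (f : Pol n) → Homogeneous i f →
        InIdeal (Gen Γ Θ) ((linPoly ω ^ₚ (s ∸ℕ 2 *ℕ i)) *ₚ f) →
        InIdeal (Gen Γ Θ) f
  where open Poly K

-- Give cone(Δ) the l.s.o.p. x₀, θ₁, …, θ_d, where x₀ is the apex variable and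
-- the θ_j do not involve x₀, and keep the same ω.  Setting x₀ = 0 is a ring map
-- A' → A carrying the ideal J' = I_cone(Δ) + (x₀, Θ) into J = I_Δ + (Θ): it fixes
-- each θ_j, sends the nonfaces of cone(Δ) avoiding the apex to the nonfaces of Δ,
-- and kills every other generator.  Conversely every polynomial is its value at
-- x₀ = 0 plus a multiple of x₀ ∈ J', and A ⊆ A' carries J into J'; so f ∈ J' iff
-- f|_{x₀=0} ∈ J.  Hence A'/J' ≅ A/J, compatibly with degrees and with
-- multiplication by ω^{s-2i}.
module Submission where

open import Defs
open import Level using (Level; _⊔_)
open import Data.Nat using (ℕ; zero; suc)
import Data.Nat as ℕ
import Data.Nat.Properties as ℕ
open import Data.Bool using (true; false)
open import Data.Fin using (Fin) renaming (zero to fzero; suc to fsuc)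
import Data.Fin.Subset as Subset
open import Data.Vec using (Vec; _∷_; replicate; zipWith; lookup) renaming (map to vmap)
open import Data.Vec.Properties
  using (≡-dec; lookup-map; lookup-replicate; ∷-injectiveʳ; zipWith-identityʳ; zipWith-replicate)
open import Data.List using (List; []; _∷_; _++_; map; concatMap; allFin; tabulate)
open import Data.List.Properties using (++-assoc; ++-identityʳ; map-++)
open import Data.List.Relation.Unary.All using (All; []; _∷_)
import Data.List.Relation.Unary.All as All
import Data.List.Relation.Unary.All.Properties as All
open import Data.List.Membership.Propositional using (_∈_)
open import Data.List.Membership.Propositional.Properties using (∈-map⁺)
open import Data.Product using (Σ; _×_; _,_; proj₁; proj₂; map₂)
open import Data.Sum using (inj₁; inj₂)
open import Data.Empty using (⊥-elim)
open import Function using (_∘_; id)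
open import Relation.Nullary using (¬_; yes; no)
open import Relation.Binary.PropositionalEquality as ≡ using (_≡_; cong; cong₂)
import Relation.Binary.Reasoning.Setoid as SetoidReasoning
import Algebra.Properties.CommutativeSemigroup as CommutativeSemigroupProperties

module Polynomials {c ℓ : Level} (K : Field c ℓ) where
  open Field K
  open Poly K
  open CommutativeSemigroupProperties +-commutativeSemigroup using (x∙yz≈y∙xz)

  termCoeff : ∀ {n} → Carrier → Monomial n → Monomial n → Carrier
  termCoeff k a m with ≡-dec ℕ._≟_ a m
  ... | yes _ = k
  ... | no  _ = 0#

  coeff-∷ : ∀ {n} k (a : Monomial n) p m → coeff ((k , a) ∷ p) m ≈ termCoeff k a m + coeff p m
  coeff-∷ k a p m with ≡-dec ℕ._≟_ a m
  ... | yes _ = refl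
  ... | no  _ = sym (+-identityˡ _)

  termCoeff-≢ : ∀ {n} k (a m : Monomial n) → ¬ a ≡ m → termCoeff k a m ≡ 0#
  termCoeff-≢ k a m a≢m with ≡-dec ℕ._≟_ a m
  ... | yes a≡m = ⊥-elim (a≢m a≡m)
  ... | no  _   = ≡.refl

  termCoeff-⇔ : ∀ {n n'} k (a m : Monomial n) (a' m' : Monomial n') →
                (a ≡ m → a' ≡ m') → (a' ≡ m' → a ≡ m) → termCoeff k a m ≡ termCoeff k a' m'
  termCoeff-⇔ k a m a' m' to from with ≡-dec ℕ._≟_ a m | ≡-dec ℕ._≟_ a' m'
  ... | yes _   | yes _    = ≡.refl
  ... | no  _   | no  _    = ≡.refl
  ... | yes a≡m | no  a'≢m' = ⊥-elim (a'≢m' (to a≡m))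
  ... | no  a≢m | yes a'≡m' = ⊥-elim (a≢m (from a'≡m'))

  termCoeff-cong : ∀ {n} {k k'} (a m : Monomial n) → k ≈ k' → termCoeff k a m ≈ termCoeff k' a m
  termCoeff-cong a m k≈k' with ≡-dec ℕ._≟_ a m
  ... | yes _ = k≈k'
  ... | no  _ = refl

  termCoeff-zero : ∀ {n} {k} (a m : Monomial n) → k ≈ 0# → termCoeff k a m ≈ 0#
  termCoeff-zero a m k≈0 with ≡-dec ℕ._≟_ a m
  ... | yes _ = k≈0
  ... | no  _ = refl

  coeff-++ : ∀ {n} (p q : Pol n) m → coeff (p ++ q) m ≈ coeff p m + coeff q m
  coeff-++ []            q m = sym (+-identityˡ _)
  coeff-++ ((k , a) ∷ p) q m = begin
    coeff ((k , a) ∷ (p ++ q)) m              ≈⟨ coeff-∷ k a (p ++ q) m ⟩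
    termCoeff k a m + coeff (p ++ q) m        ≈⟨ +-congˡ (coeff-++ p q m) ⟩
    termCoeff k a m + (coeff p m + coeff q m) ≈⟨ +-assoc _ _ _ ⟨
    (termCoeff k a m + coeff p m) + coeff q m ≈⟨ +-congʳ (coeff-∷ k a p m) ⟨
    coeff ((k , a) ∷ p) m + coeff q m         ∎
    where open SetoidReasoning setoid

  ∷-cong : ∀ {n} t {p q : Pol n} → p ≈ₚ q → (t ∷ p) ≈ₚ (t ∷ q)
  ∷-cong (k , a) {p} {q} p≈q m = trans (coeff-∷ k a p m) (trans (+-congˡ (p≈q m)) (sym (coeff-∷ k a q m)))

  shift-≈ₚ : ∀ {n} (p : Pol n) t q → (p ++ t ∷ q) ≈ₚ (t ∷ p ++ q)
  shift-≈ₚ p (k , a) q m = begin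
    coeff (p ++ (k , a) ∷ q) m                     ≈⟨ coeff-++ p ((k , a) ∷ q) m ⟩
    coeff p m + coeff ((k , a) ∷ q) m              ≈⟨ +-congˡ (coeff-∷ k a q m) ⟩
    coeff p m + (termCoeff k a m + coeff q m)      ≈⟨ x∙yz≈y∙xz _ _ _ ⟩
    termCoeff k a m + (coeff p m + coeff q m)      ≈⟨ +-congˡ (coeff-++ p q m) ⟨
    termCoeff k a m + coeff (p ++ q) m             ≈⟨ coeff-∷ k a (p ++ q) m ⟨
    coeff ((k , a) ∷ p ++ q) m                     ∎
    where open SetoidReasoning setoid

  AllZero : ∀ {n} → Pol n → Set (c ⊔ ℓ)
  AllZero = All (λ t → proj₁ t ≈ 0#)

  coeff-AllZero : ∀ {n} {p : Pol n} → AllZero p → ∀ m → coeff p m ≈ 0#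
  coeff-AllZero {p = []}          []         m = refl
  coeff-AllZero {p = (k , a) ∷ p} (k≈0 ∷ zs) m = begin
    coeff ((k , a) ∷ p) m          ≈⟨ coeff-∷ k a p m ⟩
    termCoeff k a m + coeff p m    ≈⟨ +-cong (termCoeff-zero a m k≈0) (coeff-AllZero zs m) ⟩
    0# + 0#                        ≈⟨ +-identityˡ 0# ⟩
    0#                             ∎
    where open SetoidReasoning setoid

  *ₚ-∷ˡ : ∀ {n} (t : Carrier × Monomial n) p q → (t ∷ p) *ₚ q ≡ ((t ∷ []) *ₚ q) ++ (p *ₚ q)
  *ₚ-∷ˡ t p q = cong (_++ (p *ₚ q)) (≡.sym (++-identityʳ _))

  AllZero-*ₚʳ : ∀ {n} (p : Pol n) {q} → AllZero q → AllZero (p *ₚ q)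
  AllZero-*ₚʳ []            zs = []
  AllZero-*ₚʳ ((k , a) ∷ p) {q} zs =
    ≡.subst AllZero (≡.sym (*ₚ-∷ˡ (k , a) p q)) (All.++⁺ (single zs) (AllZero-*ₚʳ p zs))
    where
    single : ∀ {q} → AllZero q → AllZero (((k , a) ∷ []) *ₚ q)
    single []         = []
    single (l≈0 ∷ zs) = trans (*-congˡ l≈0) (zeroʳ k) ∷ single zs

  *ₚ-zero-∷ʳ : ∀ {n} (p : Pol n) {k} b L → k ≈ 0# → (p *ₚ ((k , b) ∷ L)) ≈ₚ (p *ₚ L)
  *ₚ-zero-∷ʳ []            b L k≈0 m = refl
  *ₚ-zero-∷ʳ ((l , a) ∷ p) {k} b L k≈0 m = begin
    coeff (((l , a) ∷ p) *ₚ ((k , b) ∷ L)) m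
      ≡⟨ cong (λ x → coeff x m) (*ₚ-∷ˡ (l , a) p ((k , b) ∷ L)) ⟩
    coeff (((l , a) ∷ []) *ₚ ((k , b) ∷ L) ++ (p *ₚ ((k , b) ∷ L))) m
      ≈⟨ coeff-++ (((l , a) ∷ []) *ₚ ((k , b) ∷ L)) _ m ⟩
    coeff (((l , a) ∷ []) *ₚ ((k , b) ∷ L)) m + coeff (p *ₚ ((k , b) ∷ L)) m
      ≈⟨ +-cong dropHead (*ₚ-zero-∷ʳ p b L k≈0 m) ⟩
    coeff (((l , a) ∷ []) *ₚ L) m + coeff (p *ₚ L) m
      ≈⟨ sym (coeff-++ (((l , a) ∷ []) *ₚ L) _ m) ⟩
    coeff (((l , a) ∷ []) *ₚ L ++ (p *ₚ L)) m
      ≡⟨ cong (λ x → coeff x m) (≡.sym (*ₚ-∷ˡ (l , a) p L)) ⟩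
    coeff (((l , a) ∷ p) *ₚ L) m ∎
    where
    open SetoidReasoning setoid
    ab = zipWith ℕ._+_ a b
    dropHead : coeff ((l * k , ab) ∷ (((l , a) ∷ []) *ₚ L)) m ≈ coeff (((l , a) ∷ []) *ₚ L) m
    dropHead = trans (coeff-∷ (l * k) ab _ m)
      (trans (+-congʳ (termCoeff-zero ab m (trans (*-congˡ k≈0) (zeroʳ l)))) (+-identityˡ _))

  sumOfProducts : ∀ {n} → List (Pol n × Pol n) → Pol n
  sumOfProducts l = sumₚ (map (λ qg → proj₁ qg *ₚ proj₂ qg) l)

  sumOfProducts-++ : ∀ {n} (l l' : List (Pol n × Pol n)) →
                     sumOfProducts (l ++ l') ≡ sumOfProducts l ++ sumOfProducts l'
  sumOfProducts-++ []             l' = ≡.refl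
  sumOfProducts-++ ((q , g) ∷ l) l' =
    ≡.trans (cong (q *ₚ g ++_) (sumOfProducts-++ l l')) (≡.sym (++-assoc (q *ₚ g) _ _))

  module _ {n s} {S : Pol n → Set s} where

    InIdeal-≈ : ∀ {f g} → InIdeal S f → g ≈ₚ f → InIdeal S g
    InIdeal-≈ (l , gens , f≈) g≈f = l , gens , λ m → trans (g≈f m) (f≈ m)

    InIdeal-++ : ∀ {f g} → InIdeal S f → InIdeal S g → InIdeal S (f ++ g)
    InIdeal-++ {f} {g} (l , gens , f≈) (l' , gens' , g≈) = l ++ l' , All.++⁺ gens gens' , λ m → begin
      coeff (f ++ g) m                                       ≈⟨ coeff-++ f g m ⟩
      coeff f m + coeff g m                                  ≈⟨ +-cong (f≈ m) (g≈ m) ⟩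
      coeff (sumOfProducts l) m + coeff (sumOfProducts l') m ≈⟨ coeff-++ (sumOfProducts l) _ m ⟨
      coeff (sumOfProducts l ++ sumOfProducts l') m          ≡⟨ cong (λ x → coeff x m) (sumOfProducts-++ l l') ⟨
      coeff (sumOfProducts (l ++ l')) m                      ∎
      where open SetoidReasoning setoid

    InIdeal-AllZero : ∀ {f} → AllZero f → InIdeal S f
    InIdeal-AllZero zs = [] , [] , coeff-AllZero zs

    InIdeal-*gen : ∀ q {g} → S g → InIdeal S (q *ₚ g)
    InIdeal-*gen q {g} sg = (q , g) ∷ [] , sg ∷ [] , λ m → sym (trans (coeff-++ (q *ₚ g) [] m) (+-identityʳ _))

  record IsPolyHom {m n} (φ : Pol m → Pol n) : Set (c ⊔ ℓ) where
    field
      []-homo  : φ [] ≡ []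
      ++-homo  : ∀ p q → φ (p ++ q) ≡ φ p ++ φ q
      *ₚ-homo  : ∀ p q → φ (p *ₚ q) ≡ φ p *ₚ φ q
      ≈ₚ-cong  : ∀ {p q} → p ≈ₚ q → φ p ≈ₚ φ q

  InIdeal-map : ∀ {m n s t} {S : Pol m → Set s} {T : Pol n → Set t} {φ : Pol m → Pol n} →
                IsPolyHom φ → (∀ {g} → S g → ∀ q → InIdeal T (q *ₚ φ g)) →
                ∀ {f} → InIdeal S f → InIdeal T (φ f)
  InIdeal-map {S = S} {T} {φ} hom image {f} (l , gens , f≈) =
    InIdeal-≈ {f = φ (sumOfProducts l)} {g = φ f} (sumOfProducts-image l gens) (≈ₚ-cong f≈)
    where
    open IsPolyHom hom
    sumOfProducts-image : ∀ l → All (S ∘ proj₂) l → InIdeal T (φ (sumOfProducts l))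
    sumOfProducts-image []            []          = ≡.subst (InIdeal T) (≡.sym []-homo) ([] , [] , λ m → refl)
    sumOfProducts-image ((q , g) ∷ l) (sg ∷ gens) =
      ≡.subst (InIdeal T) (≡.sym (≡.trans (++-homo (q *ₚ g) _) (cong (_++ φ (sumOfProducts l)) (*ₚ-homo q g))))
        (InIdeal-++ {f = φ q *ₚ φ g} (image sg (φ q)) (sumOfProducts-image l gens))

  -- The variable of index 0 plays the apex x₀: embed is the inclusion A ⊆ A',
  -- restrict sets x₀ = 0, and apexPart keeps the terms divisible by x₀.
  embedTerm : ∀ {n} → Carrier × Monomial n → Carrier × Monomial (suc n)
  embedTerm (k , a) = k , 0 ∷ a

  embed : ∀ {n} → Pol n → Pol (suc n)
  embed = map embedTerm

  restrict : ∀ {n} → Pol (suc n) → Pol n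
  restrict []                  = []
  restrict ((k , zero  ∷ a) ∷ p) = (k , a) ∷ restrict p
  restrict ((k , suc _ ∷ _) ∷ p) = restrict p

  apexPart : ∀ {n} → Pol (suc n) → Pol (suc n)
  apexPart []                  = []
  apexPart ((k , zero  ∷ a) ∷ p) = apexPart p
  apexPart ((k , suc e ∷ a) ∷ p) = (k , suc e ∷ a) ∷ apexPart p

  embed-*ₚ : ∀ {n} (p q : Pol n) → embed (p *ₚ q) ≡ embed p *ₚ embed q
  embed-*ₚ []            q = ≡.refl
  embed-*ₚ ((k , a) ∷ p) q = begin
    embed (((k , a) ∷ p) *ₚ q)                            ≡⟨ cong embed (*ₚ-∷ˡ (k , a) p q) ⟩
    embed (((k , a) ∷ []) *ₚ q ++ p *ₚ q)                 ≡⟨ map-++ embedTerm (((k , a) ∷ []) *ₚ q) _ ⟩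
    embed (((k , a) ∷ []) *ₚ q) ++ embed (p *ₚ q)         ≡⟨ cong₂ _++_ (single q) (embed-*ₚ p q) ⟩
    ((k , 0 ∷ a) ∷ []) *ₚ embed q ++ embed p *ₚ embed q   ≡⟨ *ₚ-∷ˡ (k , 0 ∷ a) (embed p) (embed q) ⟨
    embed ((k , a) ∷ p) *ₚ embed q                         ∎
    where
    open ≡.≡-Reasoning
    single : ∀ q → embed (((k , a) ∷ []) *ₚ q) ≡ ((k , 0 ∷ a) ∷ []) *ₚ embed q
    single []            = ≡.refl
    single ((l , b) ∷ q) = cong ((k * l , 0 ∷ zipWith ℕ._+_ a b) ∷_) (single q)

  restrict-++ : ∀ {n} (p q : Pol (suc n)) → restrict (p ++ q) ≡ restrict p ++ restrict q
  restrict-++ []                    q = ≡.refl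
  restrict-++ ((k , zero  ∷ a) ∷ p) q = cong ((k , a) ∷_) (restrict-++ p q)
  restrict-++ ((k , suc _ ∷ _) ∷ p) q = restrict-++ p q

  restrict-embed : ∀ {n} (p : Pol n) → restrict (embed p) ≡ p
  restrict-embed []            = ≡.refl
  restrict-embed ((k , a) ∷ p) = cong ((k , a) ∷_) (restrict-embed p)

  restrict-neg : ∀ {n} (p : Pol (suc n)) → restrict (-ₚ p) ≡ -ₚ restrict p
  restrict-neg []                    = ≡.refl
  restrict-neg ((k , zero  ∷ a) ∷ p) = cong ((- k , a) ∷_) (restrict-neg p)
  restrict-neg ((k , suc _ ∷ _) ∷ p) = restrict-neg p

  restrict-*ₚ : ∀ {n} (p q : Pol (suc n)) → restrict (p *ₚ q) ≡ restrict p *ₚ restrict q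
  restrict-*ₚ []                    q = ≡.refl
  restrict-*ₚ ((k , zero ∷ a) ∷ p)  q = begin
    restrict (((k , 0 ∷ a) ∷ p) *ₚ q)
      ≡⟨ cong restrict (*ₚ-∷ˡ (k , 0 ∷ a) p q) ⟩
    restrict (((k , 0 ∷ a) ∷ []) *ₚ q ++ p *ₚ q)
      ≡⟨ restrict-++ (((k , 0 ∷ a) ∷ []) *ₚ q) _ ⟩
    restrict (((k , 0 ∷ a) ∷ []) *ₚ q) ++ restrict (p *ₚ q)
      ≡⟨ cong₂ _++_ (single q) (restrict-*ₚ p q) ⟩
    ((k , a) ∷ []) *ₚ restrict q ++ restrict p *ₚ restrict q
      ≡⟨ *ₚ-∷ˡ (k , a) (restrict p) (restrict q) ⟨
    restrict ((k , 0 ∷ a) ∷ p) *ₚ restrict q ∎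
    where
    open ≡.≡-Reasoning
    single : ∀ q → restrict (((k , 0 ∷ a) ∷ []) *ₚ q) ≡ ((k , a) ∷ []) *ₚ restrict q
    single []                    = ≡.refl
    single ((l , zero  ∷ b) ∷ q) = cong ((k * l , zipWith ℕ._+_ a b) ∷_) (single q)
    single ((l , suc _ ∷ _) ∷ q) = single q
  restrict-*ₚ ((k , suc e ∷ a) ∷ p) q = begin
    restrict (((k , suc e ∷ a) ∷ p) *ₚ q)
      ≡⟨ cong restrict (*ₚ-∷ˡ (k , suc e ∷ a) p q) ⟩
    restrict (((k , suc e ∷ a) ∷ []) *ₚ q ++ p *ₚ q)
      ≡⟨ restrict-++ (((k , suc e ∷ a) ∷ []) *ₚ q) _ ⟩
    restrict (((k , suc e ∷ a) ∷ []) *ₚ q) ++ restrict (p *ₚ q)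
      ≡⟨ cong₂ _++_ (vanishes q) (restrict-*ₚ p q) ⟩
    restrict p *ₚ restrict q ∎
    where
    open ≡.≡-Reasoning
    vanishes : ∀ q → restrict (((k , suc e ∷ a) ∷ []) *ₚ q) ≡ []
    vanishes []                = ≡.refl
    vanishes ((l , _ ∷ _) ∷ q) = vanishes q

  restrict-^ₚ : ∀ {n} (p : Pol (suc n)) k → restrict (p ^ₚ k) ≡ restrict p ^ₚ k
  restrict-^ₚ p zero    = ≡.refl
  restrict-^ₚ p (suc k) = ≡.trans (restrict-*ₚ p (p ^ₚ k)) (cong (restrict p *ₚ_) (restrict-^ₚ p k))

  coeff-restrict : ∀ {n} (p : Pol (suc n)) m → coeff (restrict p) m ≈ coeff p (0 ∷ m)
  coeff-restrict []                    m = refl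
  coeff-restrict ((k , zero ∷ a) ∷ p)  m = begin
    coeff ((k , a) ∷ restrict p) m               ≈⟨ coeff-∷ k a (restrict p) m ⟩
    termCoeff k a m + coeff (restrict p) m
      ≈⟨ +-cong (reflexive (termCoeff-⇔ k a m (0 ∷ a) (0 ∷ m) (cong (0 ∷_)) ∷-injectiveʳ)) (coeff-restrict p m) ⟩
    termCoeff k (0 ∷ a) (0 ∷ m) + coeff p (0 ∷ m) ≈⟨ coeff-∷ k (0 ∷ a) p (0 ∷ m) ⟨
    coeff ((k , 0 ∷ a) ∷ p) (0 ∷ m)              ∎
    where open SetoidReasoning setoid
  coeff-restrict ((k , suc e ∷ a) ∷ p) m = begin
    coeff (restrict p) m                               ≈⟨ coeff-restrict p m ⟩
    coeff p (0 ∷ m)                                    ≈⟨ +-identityˡ _ ⟨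
    0# + coeff p (0 ∷ m)                               ≡⟨ cong (_+ coeff p (0 ∷ m)) (termCoeff-≢ k (suc e ∷ a) (0 ∷ m) (λ ())) ⟨
    termCoeff k (suc e ∷ a) (0 ∷ m) + coeff p (0 ∷ m)  ≈⟨ coeff-∷ k (suc e ∷ a) p (0 ∷ m) ⟨
    coeff ((k , suc e ∷ a) ∷ p) (0 ∷ m)                ∎
    where open SetoidReasoning setoid

  restrict-cong : ∀ {n} {p q : Pol (suc n)} → p ≈ₚ q → restrict p ≈ₚ restrict q
  restrict-cong {p = p} {q} p≈q m = trans (coeff-restrict p m) (trans (p≈q (0 ∷ m)) (sym (coeff-restrict q m)))

  coeff-embed-suc : ∀ {n} (p : Pol n) e m → coeff (embed p) (suc e ∷ m) ≈ 0#
  coeff-embed-suc []            e m = refl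
  coeff-embed-suc ((k , a) ∷ p) e m = begin
    coeff ((k , 0 ∷ a) ∷ embed p) (suc e ∷ m)
      ≈⟨ coeff-∷ k (0 ∷ a) (embed p) (suc e ∷ m) ⟩
    termCoeff k (0 ∷ a) (suc e ∷ m) + coeff (embed p) (suc e ∷ m)
      ≈⟨ +-cong (reflexive (termCoeff-≢ k (0 ∷ a) (suc e ∷ m) (λ ()))) (coeff-embed-suc p e m) ⟩
    0# + 0# ≈⟨ +-identityˡ 0# ⟩
    0#      ∎
    where open SetoidReasoning setoid

  embed-cong : ∀ {n} {p q : Pol n} → p ≈ₚ q → embed p ≈ₚ embed q
  embed-cong {p = p} {q} p≈q (zero ∷ m) = begin
    coeff (embed p) (0 ∷ m)            ≈⟨ coeff-restrict (embed p) m ⟨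
    coeff (restrict (embed p)) m       ≡⟨ cong (λ x → coeff x m) (restrict-embed p) ⟩
    coeff p m                          ≈⟨ p≈q m ⟩
    coeff q m                          ≡⟨ cong (λ x → coeff x m) (restrict-embed q) ⟨
    coeff (restrict (embed q)) m       ≈⟨ coeff-restrict (embed q) m ⟩
    coeff (embed q) (0 ∷ m)            ∎
    where open SetoidReasoning setoid
  embed-cong {p = p} {q} p≈q (suc e ∷ m) = trans (coeff-embed-suc p e m) (sym (coeff-embed-suc q e m))

  embed-isPolyHom : ∀ {n} → IsPolyHom (embed {n})
  embed-isPolyHom = record
    { []-homo  = ≡.refl
    ; ++-homo  = map-++ embedTerm
    ; *ₚ-homo  = embed-*ₚ
    ; ≈ₚ-cong  = λ {p} {q} → embed-cong {p = p} {q}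
    }

  restrict-isPolyHom : ∀ {n} → IsPolyHom (restrict {n})
  restrict-isPolyHom = record
    { []-homo  = ≡.refl
    ; ++-homo  = restrict-++
    ; *ₚ-homo  = restrict-*ₚ
    ; ≈ₚ-cong  = λ {p} {q} → restrict-cong {p = p} {q}
    }

  ≈ₚ-embed-restrict-++-apexPart : ∀ {n} (p : Pol (suc n)) → p ≈ₚ (embed (restrict p) ++ apexPart p)
  ≈ₚ-embed-restrict-++-apexPart []                    m = refl
  ≈ₚ-embed-restrict-++-apexPart ((k , zero  ∷ a) ∷ p)   = ∷-cong (k , 0 ∷ a) (≈ₚ-embed-restrict-++-apexPart p)
  ≈ₚ-embed-restrict-++-apexPart ((k , suc e ∷ a) ∷ p) m =
    trans (∷-cong (k , suc e ∷ a) (≈ₚ-embed-restrict-++-apexPart p) m)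
          (sym (shift-≈ₚ (embed (restrict p)) (k , suc e ∷ a) (apexPart p) m))

  linPoly-∷ : ∀ {n} k (θ : LinForm {n}) → linPoly (k ∷ θ) ≡ (const k *ₚ var fzero) ++ embed (linPoly θ)
  linPoly-∷ {n} k θ = cong ((const k *ₚ var fzero) ++_) (shifted id)
    where
    shifted : ∀ {r} (h : Fin r → Fin n) →
      concatMap (λ i → const (lookup (k ∷ θ) i) *ₚ var i) (tabulate (fsuc ∘ h))
        ≡ embed (concatMap (λ i → const (lookup θ i) *ₚ var i) (tabulate h))
    shifted {zero}  h = ≡.refl
    shifted {suc r} h = ≡.trans
      (cong (embed (const (lookup θ (h fzero)) *ₚ var (h fzero)) ++_) (shifted (h ∘ fsuc)))
      (≡.sym (map-++ embedTerm (const (lookup θ (h fzero)) *ₚ var (h fzero)) _))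

  restrict-linPoly-∷ : ∀ {n} k (θ : LinForm {n}) → restrict (linPoly (k ∷ θ)) ≡ linPoly θ
  restrict-linPoly-∷ k θ = ≡.trans (cong restrict (linPoly-∷ k θ)) (restrict-embed (linPoly θ))

  AllZero-linPoly-0 : ∀ {n} → AllZero (linPoly (replicate n 0#))
  AllZero-linPoly-0 {n} = go (allFin n)
    where
    go : (is : List (Fin n)) → AllZero (concatMap (λ i → const (lookup (replicate n 0#) i) *ₚ var i) is)
    go []       = []
    go (i ∷ is) = trans (*-congʳ (reflexive (lookup-replicate i 0#))) (zeroˡ 1#) ∷ go is

  apexForm : ∀ {n} → LinForm {suc n}
  apexForm {n} = 1# ∷ replicate n 0#

  apexTerm-factor : ∀ {n} k e (a : Monomial n) →
                    ((k , suc e ∷ a) ∷ []) ≈ₚ (((k , e ∷ a) ∷ []) *ₚ linPoly apexForm)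
  apexTerm-factor {n} k e a m = begin
    coeff ((k , suc e ∷ a) ∷ []) m          ≈⟨ coeff-∷ k (suc e ∷ a) [] m ⟩
    termCoeff k (suc e ∷ a) m + 0#          ≡⟨ cong (λ b → termCoeff k b m + 0#) exponent ⟩
    termCoeff k b m + 0#                    ≈⟨ +-cong (termCoeff-cong b m k≈k11) (coeff-AllZero rest m) ⟨
    termCoeff (k * (1# * 1#)) b m + coeff (x *ₚ embed (linPoly (replicate n 0#))) m
      ≈⟨ coeff-∷ (k * (1# * 1#)) b _ m ⟨
    coeff (x *ₚ ((const 1# *ₚ var fzero) ++ embed (linPoly (replicate n 0#)))) m
      ≡⟨ cong (λ y → coeff (x *ₚ y) m) (linPoly-∷ 1# (replicate n 0#)) ⟨
    coeff (x *ₚ linPoly apexForm) m         ∎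
    where
    open SetoidReasoning setoid
    x = (k , e ∷ a) ∷ []
    b = (e ℕ.+ 1) ∷ zipWith ℕ._+_ a (zipWith ℕ._+_ (replicate n 0) (replicate n 0))
    exponent : suc e ∷ a ≡ b
    exponent = cong₂ _∷_ (ℕ.+-comm 1 e)
      (≡.sym (≡.trans (cong (zipWith ℕ._+_ a) (zipWith-replicate ℕ._+_ 0 0)) (zipWith-identityʳ ℕ.+-identityʳ a)))
    k≈k11 : k * (1# * 1#) ≈ k
    k≈k11 = trans (*-congˡ (*-identityˡ 1#)) (*-identityʳ k)
    rest : AllZero (x *ₚ embed (linPoly (replicate n 0#)))
    rest = AllZero-*ₚʳ x (All.map⁺ AllZero-linPoly-0)

  restrict-linPoly-^ₚ-*ₚ : ∀ {n} k (ω : LinForm {n}) r f →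
    restrict ((linPoly (k ∷ ω) ^ₚ r) *ₚ f) ≡ (linPoly ω ^ₚ r) *ₚ restrict f
  restrict-linPoly-^ₚ-*ₚ k ω r f = ≡.trans (restrict-*ₚ (linPoly (k ∷ ω) ^ₚ r) f)
    (cong (_*ₚ restrict f) (≡.trans (restrict-^ₚ (linPoly (k ∷ ω)) r) (cong (_^ₚ r) (restrict-linPoly-∷ k ω))))

  linearCombination : ∀ {n} → List (Carrier × Pol n) → Pol n
  linearCombination cs = sumₚ (map (λ cb → const (proj₁ cb) *ₚ proj₂ cb) cs)

  restrict-linearCombination-embed : ∀ {n} (cs : List (Carrier × Pol n)) →
    restrict (linearCombination (map (map₂ embed) cs)) ≡ linearCombination cs
  restrict-linearCombination-embed []             = ≡.refl
  restrict-linearCombination-embed ((k , b) ∷ cs) = begin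
    restrict (const k *ₚ embed b ++ embedded)
      ≡⟨ restrict-++ (const k *ₚ embed b) embedded ⟩
    restrict (const k *ₚ embed b) ++ restrict embedded
      ≡⟨ cong₂ _++_ (≡.trans (restrict-*ₚ (const k) (embed b)) (cong (const k *ₚ_) (restrict-embed b)))
                    (restrict-linearCombination-embed cs) ⟩
    const k *ₚ b ++ linearCombination cs ∎
    where
    open ≡.≡-Reasoning
    embedded = linearCombination (map (map₂ embed) cs)

  restrict-homogeneous : ∀ {n} i {f : Pol (suc n)} → Homogeneous i f → Homogeneous i (restrict f)
  restrict-homogeneous i {[]}                  []       = []
  restrict-homogeneous i {(k , zero ∷ a) ∷ p}  (h ∷ hs) = h ∷ restrict-homogeneous i hs
  restrict-homogeneous i {(k , suc _ ∷ _) ∷ p} (_ ∷ hs) = restrict-homogeneous i hs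

hasDim-cone : ∀ {n} {Δ : SimplicialComplex n} {d} → HasDim Δ d → HasDim (cone Δ) (suc d)
hasDim-cone {Δ = Δ} {d} ((F , face , ∣F∣≡d) , bound) = (true ∷ F , face , cong suc ∣F∣≡d) , coneBound
  where
  coneBound : ∀ G → SimplicialComplex.Face (cone Δ) G → Subset.∣ G ∣ ℕ.≤ suc d
  coneBound (true  ∷ G) face = ℕ.s≤s (bound G face)
  coneBound (false ∷ G) face = ℕ.m≤n⇒m≤1+n (bound G face)

module Cone {c ℓ} (K : Field c ℓ) {n d : ℕ} (Δ : SimplicialComplex n) (Θ : Vec (Poly.LinForm K {n}) d) where
  open Field K
  open Poly K
  open Polynomials K

  coneLSOP : Vec (LinForm {suc n}) (suc d)
  coneLSOP = apexForm ∷ vmap (0# ∷_) Θ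

  J : Pol n → Set c
  J = Gen Δ Θ

  J' : Pol (suc n) → Set c
  J' = Gen (cone Δ) coneLSOP

  lookup-coneLSOP : ∀ j → lookup coneLSOP (fsuc j) ≡ 0# ∷ lookup Θ j
  lookup-coneLSOP j = lookup-map j (0# ∷_) Θ

  embed-InIdeal : ∀ {f} → InIdeal J f → InIdeal J' (embed f)
  embed-InIdeal {f} = InIdeal-map embed-isPolyHom image {f}
    where
    image : ∀ {g} → J g → ∀ q → InIdeal J' (q *ₚ embed g)
    image (inj₁ (j , ≡.refl)) q =
      InIdeal-≈ {f = q *ₚ ((const 0# *ₚ var fzero) ++ θⱼ)} {g = q *ₚ θⱼ}
        (≡.subst (λ h → InIdeal J' (q *ₚ h)) extended (InIdeal-*gen q (inj₁ (fsuc j , ≡.refl))))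
        (λ m → sym (*ₚ-zero-∷ʳ q _ θⱼ (zeroˡ 1#) m))
      where
      θⱼ = embed (linPoly (lookup Θ j))
      extended : linPoly (lookup coneLSOP (fsuc j)) ≡ (const 0# *ₚ var fzero) ++ θⱼ
      extended = ≡.trans (cong linPoly (lookup-coneLSOP j)) (linPoly-∷ 0# (lookup Θ j))
    image (inj₂ (G , nonface , ≡.refl)) q = InIdeal-*gen q (inj₂ (false ∷ G , nonface , ≡.refl))

  restrict-InIdeal : ∀ {f} → InIdeal J' f → InIdeal J (restrict f)
  restrict-InIdeal {f} = InIdeal-map restrict-isPolyHom image {f}
    where
    image : ∀ {g} → J' g → ∀ q → InIdeal J (q *ₚ restrict g)
    image (inj₁ (fzero , ≡.refl)) q = InIdeal-AllZero
      (AllZero-*ₚʳ q (≡.subst AllZero (≡.sym (restrict-linPoly-∷ 1# (replicate n 0#))) AllZero-linPoly-0))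
    image (inj₁ (fsuc j , ≡.refl)) q =
      ≡.subst (λ h → InIdeal J (q *ₚ h)) (≡.sym restricted) (InIdeal-*gen q (inj₁ (j , ≡.refl)))
      where
      restricted : restrict (linPoly (lookup coneLSOP (fsuc j))) ≡ linPoly (lookup Θ j)
      restricted = ≡.trans (cong (restrict ∘ linPoly) (lookup-coneLSOP j)) (restrict-linPoly-∷ 0# (lookup Θ j))
    image (inj₂ (false ∷ G , nonface , ≡.refl)) q = InIdeal-*gen q (inj₂ (G , nonface , ≡.refl))
    image (inj₂ (true  ∷ G , _       , ≡.refl)) q = InIdeal-AllZero (AllZero-*ₚʳ q [])

  apexPart-InIdeal : ∀ f → InIdeal J' (apexPart f)
  apexPart-InIdeal []                    = [] , [] , λ m → refl
  apexPart-InIdeal ((k , zero  ∷ a) ∷ p) = apexPart-InIdeal p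
  apexPart-InIdeal ((k , suc e ∷ a) ∷ p) = InIdeal-++ {f = t} {g = apexPart p} t∈J' (apexPart-InIdeal p)
    where
    t = (k , suc e ∷ a) ∷ []
    t∈J' : InIdeal J' t
    t∈J' = InIdeal-≈ {f = ((k , e ∷ a) ∷ []) *ₚ linPoly apexForm} {g = t}
      (InIdeal-*gen ((k , e ∷ a) ∷ []) (inj₁ (fzero , ≡.refl))) (apexTerm-factor k e a)

  InIdeal-restrict⁻¹ : ∀ {f} → InIdeal J (restrict f) → InIdeal J' f
  InIdeal-restrict⁻¹ {f} I = InIdeal-≈ {f = embed (restrict f) ++ apexPart f} {g = f}
    (InIdeal-++ {f = embed (restrict f)} {g = apexPart f} (embed-InIdeal {restrict f} I) (apexPart-InIdeal f))
    (≈ₚ-embed-restrict-++-apexPart f)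

  coneFiniteDim : FiniteDimQuot Δ Θ → FiniteDimQuot (cone Δ) coneLSOP
  coneFiniteDim (B , span) = map embed B , λ f → embedSpan f (span (restrict f))
    where
    embedSpan : ∀ f → (Σ (List (Carrier × Pol n)) λ cs →
                         All (λ cb → proj₂ cb ∈ B) cs × InIdeal J (restrict f -ₚ linearCombination cs)) →
                Σ (List (Carrier × Pol (suc n))) λ cs →
                         All (λ cb → proj₂ cb ∈ map embed B) cs × InIdeal J' (f -ₚ linearCombination cs)
    embedSpan f (cs , inB , I) = map (map₂ embed) cs , All.map⁺ (All.map (∈-map⁺ embed) inB) ,
      InIdeal-restrict⁻¹ {f -ₚ embedded} (≡.subst (InIdeal J) (≡.sym restricted) I)
      where
      open ≡.≡-Reasoning
      embedded = linearCombination (map (map₂ embed) cs)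
      restricted : restrict (f -ₚ embedded) ≡ restrict f -ₚ linearCombination cs
      restricted = begin
        restrict (f -ₚ embedded)             ≡⟨ restrict-++ f (-ₚ embedded) ⟩
        restrict f ++ restrict (-ₚ embedded) ≡⟨ cong (restrict f ++_) (restrict-neg embedded) ⟩
        restrict f -ₚ restrict embedded      ≡⟨ cong (λ x → restrict f -ₚ x) (restrict-linearCombination-embed cs) ⟩
        restrict f -ₚ linearCombination cs   ∎

  coneInjective : ∀ (ω : LinForm {n}) r i →
    (∀ g → Homogeneous i g → InIdeal J ((linPoly ω ^ₚ r) *ₚ g) → InIdeal J g) →
    ∀ f → Homogeneous i f → InIdeal J' ((linPoly (0# ∷ ω) ^ₚ r) *ₚ f) → InIdeal J' f
  coneInjective ω r i injective f homogeneous ωf∈J' = InIdeal-restrict⁻¹ {f}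
    (injective (restrict f) (restrict-homogeneous i homogeneous)
      (≡.subst (InIdeal J) (restrict-linPoly-^ₚ-*ₚ 0# ω r f) (restrict-InIdeal {(linPoly (0# ∷ ω) ^ₚ r) *ₚ f} ωf∈J')))

lemma2p1 : ∀ {c ℓ} (k : Field c ℓ) → Infinite k →
    ∀ {n : ℕ} (Δ : SimplicialComplex n) (d s : ℕ) →
    HasDim Δ d → Lefschetz k Δ s → Lefschetz k (cone Δ) s
lemma2p1 k _ Δ _ s _ (d , Θ , (dimΔ , finiteΔ) , ω , injective) =
  suc d , coneLSOP , (hasDim-cone dimΔ , coneFiniteDim finiteΔ) , 0# ∷ ω ,
  λ i 2i<s → coneInjective ω (s ℕ.∸ 2 ℕ.* i) i (injective i 2i<s)
  where
  open Field k using (0#)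
  open Cone k Δ Θ
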